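{- Let $A$ be a positive quasi-Cartan matrix. Then no subdiagram of $\Gamma(A)$ (i.e. no induced subgraph of $\Gamma(A)$ with the inherited edge weights) is isomorphic, as an edge-weighted graph, to any of the following: $\widetilde{\mathbb{C}}_2$: a path on $3$ vertices with both edges of weight $2$; $\widetilde{\mathbb{C}}_n$ ($n>2$): a path on $n+1$ vertices whose two end edges have weight $2$ and all other edges weight $1$; $\widetilde{\mathbb{B}}_3$: a star with a center joined to three leaves, one of these edges of weight $2$ and the other two of weight $1$; $\widetilde{\mathbb{D}}_4$: a star with a center joined to four leaves, all edges of weight $1$; $\widetilde{\mathbb{G}}_2$: a path on $3$ vertices with edge weights $3$ and $a$, where $a\ge1$ is any integer.
   Context: A quasi-Cartan matrix is a square integer matrix $A$ with all diagonal entries $2$ such that $DA$ is symmetric for some diagonal $D$ with positive diagonal entries; it is positive if $DA$ is positive definite. The diagram $\Gamma(A)$ of an $n\times n$ quasi-Cartan matrix $A$ is the undirected graph on $\{1,\dots,n\}$ with an edge $\{i,j\}$ for each $i\neq j$ with $A_{ij}\neq0$, carrying weight $A_{ij}A_{ji}$ (and sign $-\operatorname{sgn}(A_{ij})$). A subdiagram of $\Gamma(A)$ is the diagram $\Gamma(A')$ of a principal submatrix $A'$ of $A$.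
   Formalization: The positive diagonal D making DA symmetric has rational diagonal entries, and positive definiteness of DA is tested on nonzero rational vectors. -}

module Defs where

open import Data.Nat as ℕ using (ℕ; zero; suc)
open import Data.Fin using (Fin; zero; suc; toℕ)
open import Data.Integer as ℤ using (ℤ; +_)
open import Data.Rational as ℚ using (ℚ; 0ℚ; _/_)
open import Data.Product using (Σ; ∃; _×_; _,_)
open import Relation.Binary.PropositionalEquality using (_≡_; _≢_)
open import Relation.Nullary using (¬_; yes; no)
open import Function.Definitions using (Injective)

Matrix : ℕ → Set
Matrix n = Fin n → Fin n → ℤ

ℤ→ℚ : ℤ → ℚ
ℤ→ℚ z = z / 1

Σℚ : (n : ℕ) → (Fin n → ℚ) → ℚ
Σℚ zero    f = 0ℚ
Σℚ (suc n) f = f zero ℚ.+ Σℚ n (λ i → f (suc i))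

IsSymmetrizer : {n : ℕ} → Matrix n → (Fin n → ℚ) → Set
IsSymmetrizer {n} A d =
  ((i : Fin n) → 0ℚ ℚ.< d i) ×
  ((i j : Fin n) → d i ℚ.* ℤ→ℚ (A i j) ≡ d j ℚ.* ℤ→ℚ (A j i))

IsQuasiCartan : {n : ℕ} → Matrix n → Set
IsQuasiCartan {n} A =
  ((i : Fin n) → A i i ≡ + 2) × Σ (Fin n → ℚ) (λ d → IsSymmetrizer A d)

DAPositiveDefinite : {n : ℕ} → Matrix n → (Fin n → ℚ) → Set
DAPositiveDefinite {n} A d =
  (x : Fin n → ℚ) → (Σ (Fin n) (λ i → x i ≢ 0ℚ)) →
  0ℚ ℚ.< Σℚ n (λ i → Σℚ n (λ j → x i ℚ.* (d i ℚ.* ℤ→ℚ (A i j)) ℚ.* x j))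

IsPositiveQuasiCartan : {n : ℕ} → Matrix n → Set
IsPositiveQuasiCartan {n} A =
  ((i : Fin n) → A i i ≡ + 2) ×
  Σ (Fin n → ℚ) (λ d → IsSymmetrizer A d × DAPositiveDefinite A d)

-- Edge weight of {i,j} in Γ(A) (for i ≠ j); 0 means "no edge".
weight : {n : ℕ} → Matrix n → Fin n → Fin n → ℤ
weight A i j = A i j ℤ.* A j i

-- An edge-weighted graph on Fin m: weight function (0 = no edge),
-- only consulted on pairs i ≢ j.
WGraph : ℕ → Set
WGraph m = Fin m → Fin m → ℕ

HasSubdiagram : {n m : ℕ} → Matrix n → WGraph m → Set
HasSubdiagram {n} {m} A G =
  Σ (Fin m → Fin n) (λ f → Injective _≡_ _≡_ f ×
    ((i j : Fin m) → i ≢ j → weight A (f i) (f j) ≡ + G i j))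

pathGraph : (m : ℕ) → (ℕ → ℕ) → WGraph m
pathGraph m w i j with toℕ j ℕ.≟ suc (toℕ i) | toℕ i ℕ.≟ suc (toℕ j)
... | yes _ | _     = w (toℕ i)
... | no _  | yes _ = w (toℕ j)
... | no _  | no _  = 0

starGraph : (k : ℕ) → (ℕ → ℕ) → WGraph (suc k)
starGraph k w zero    zero    = 0
starGraph k w zero    (suc j) = w (suc (toℕ j))
starGraph k w (suc i) zero    = w (suc (toℕ i))
starGraph k w (suc i) (suc j) = 0

-- C̃_n (n ≥ 2): path on n+1 vertices, edges {0,1} and {n-1,n} of weight 2,
-- all other edges weight 1.  (For n = 2 both edges have weight 2.)
Ctilde : (n : ℕ) → WGraph (suc n)
Ctilde n = pathGraph (suc n) w
  where
  w : ℕ → ℕ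
  w k with k ℕ.≟ 0 | suc k ℕ.≟ n
  ... | yes _ | _     = 2
  ... | no _  | yes _ = 2
  ... | no _  | no _  = 1

Btilde3 : WGraph 4
Btilde3 = starGraph 3 w
  where
  w : ℕ → ℕ
  w 1 = 2
  w _ = 1

Dtilde4 : WGraph 5
Dtilde4 = starGraph 4 (λ _ → 1)

Gtilde2 : ℕ → WGraph 3
Gtilde2 a = pathGraph 3 w
  where
  w : ℕ → ℕ
  w 0 = 3
  w _ = a

{-# OPTIONS --safe #-}
module Submission where

-- Every quasi-Cartan matrix B whose diagram is one of the listed ones admits a nonzero
-- integer vector y with yᵢ (B y)ᵢ ≤ 0 for all i.  For the stars (B̃₃, D̃₄, and G̃₂ seen
-- from its middle vertex) take y = (−2, B₁₀, …, B_L0): the leaf rows vanish and the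
-- centre row is Σ weights − 4 ≥ 0.  For the path C̃ₙ put s₀ = 1, sₖ₊₁ = −Bₖ₊₁,ₖ sₖ and
-- y = (2s₀, …, 2sₙ₋₁, sₙ), a kernel vector whatever the signs of the entries.  Then
-- yᵀ(DB)y = Σ dᵢ yᵢ (B y)ᵢ ≤ 0 contradicts positive definiteness of DB.  Positivity
-- passes to principal submatrices, so none of these diagrams occurs in Γ(A).

open import Defs
open import Data.Nat using (ℕ; _≤_)
open import Data.Product using (_×_)
open import Relation.Nullary using (¬_)

open import Algebra.Bundles using (CommutativeMonoid; CommutativeRing)
import Algebra.Properties.CommutativeMonoid.Sum as CommutativeMonoidSum
import Algebra.Properties.Semiring.Sum as SemiringSum
open import Data.Bool using (if_then_else_)
open import Data.Empty using (⊥)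
open import Data.Fin using (Fin; zero; suc; toℕ; punchIn; _≟_)
open import Data.Fin.Permutation using (transpose)
import Data.Fin.Properties as FinP
open import Data.Integer as ℤ using (ℤ; +_)
import Data.Integer.Properties as ℤP
open import Data.Integer.Tactic.RingSolver using (solve-∀)
open import Data.Nat as ℕ using (zero; suc; s≤s; z≤n)
import Data.Nat.Properties as ℕP
open import Data.Product using (_,_)
open import Data.Rational as ℚ using (ℚ; 0ℚ)
import Data.Rational.Properties as ℚP
open import Data.Rational.Unnormalised as ℚᵘ using (mkℚᵘ; *≡*; *≤*)
import Data.Rational.Unnormalised.Properties as ℚᵘP
open import Data.Sum using (_⊎_; inj₁; inj₂; swap)
open import Function using (_∘_)
open import Function.Bundles using (Injection)
open import Function.Definitions using (Injective)
open import Function.Properties.Inverse using (↔⇒↣)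
open import Relation.Binary.PropositionalEquality
open import Relation.Nullary using (does; yes; no; contradiction)
open import Relation.Nullary.Decidable using (dec-true; dec-false)

module _ {c ℓ} (M : CommutativeMonoid c ℓ) where
  open CommutativeMonoid M using (Carrier; _≈_; ε; ∙-congˡ; identityʳ) renaming (trans to ≈-trans)
  open CommutativeMonoidSum M using (sum; sum-remove; sum-cong-≋; sum-replicate-zero)

  sum-single : ∀ {n} (f : Fin n → Carrier) i → (∀ j → j ≢ i → f j ≈ ε) → sum f ≈ f i
  sum-single {suc n} f i vanish = ≈-trans (sum-remove {i = i} f) (≈-trans (∙-congˡ rest≈ε) (identityʳ (f i)))
    where
    rest≈ε = ≈-trans (sum-cong-≋ (λ k → vanish (punchIn i k) (FinP.punchInᵢ≢i i k))) (sum-replicate-zero n)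

module ℤΣ = SemiringSum ℤP.+-*-semiring
open SemiringSum (CommutativeRing.semiring ℚP.+-*-commutativeRing)

-- ℤ→ℚ z = z / 1 is definitionally fromℚᵘ (mkℚᵘ z 0).
toℚᵘ-ℤ→ℚ : ∀ z → ℚ.toℚᵘ (ℤ→ℚ z) ℚᵘ.≃ mkℚᵘ z 0
toℚᵘ-ℤ→ℚ z = ℚP.toℚᵘ-fromℚᵘ (mkℚᵘ z 0)

ℤ→ℚ-homo-+ : ∀ a b → ℤ→ℚ (a ℤ.+ b) ≡ ℤ→ℚ a ℚ.+ ℤ→ℚ b
ℤ→ℚ-homo-+ a b = ℚP.toℚᵘ-injective (begin
  ℚ.toℚᵘ (ℤ→ℚ (a ℤ.+ b))                      ≈⟨ toℚᵘ-ℤ→ℚ (a ℤ.+ b) ⟩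
  mkℚᵘ (a ℤ.+ b) 0                             ≈⟨ *≡* (cong (ℤ._* + 1) a+b≡a*1+b*1) ⟩
  mkℚᵘ a 0 ℚᵘ.+ mkℚᵘ b 0                       ≈⟨ ℚᵘP.+-cong (toℚᵘ-ℤ→ℚ a) (toℚᵘ-ℤ→ℚ b) ⟨
  ℚ.toℚᵘ (ℤ→ℚ a) ℚᵘ.+ ℚ.toℚᵘ (ℤ→ℚ b)          ≈⟨ ℚP.toℚᵘ-homo-+ (ℤ→ℚ a) (ℤ→ℚ b) ⟨
  ℚ.toℚᵘ (ℤ→ℚ a ℚ.+ ℤ→ℚ b)                    ∎)
  where
  open ℚᵘP.≃-Reasoning
  a+b≡a*1+b*1 = cong₂ ℤ._+_ (sym (ℤP.*-identityʳ a)) (sym (ℤP.*-identityʳ b))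

ℤ→ℚ-homo-* : ∀ a b → ℤ→ℚ (a ℤ.* b) ≡ ℤ→ℚ a ℚ.* ℤ→ℚ b
ℤ→ℚ-homo-* a b = ℚP.toℚᵘ-injective (begin
  ℚ.toℚᵘ (ℤ→ℚ (a ℤ.* b))                      ≈⟨ toℚᵘ-ℤ→ℚ (a ℤ.* b) ⟩
  mkℚᵘ a 0 ℚᵘ.* mkℚᵘ b 0                       ≈⟨ ℚᵘP.*-cong (toℚᵘ-ℤ→ℚ a) (toℚᵘ-ℤ→ℚ b) ⟨
  ℚ.toℚᵘ (ℤ→ℚ a) ℚᵘ.* ℚ.toℚᵘ (ℤ→ℚ b)          ≈⟨ ℚP.toℚᵘ-homo-* (ℤ→ℚ a) (ℤ→ℚ b) ⟨
  ℚ.toℚᵘ (ℤ→ℚ a ℚ.* ℤ→ℚ b)                    ∎)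
  where open ℚᵘP.≃-Reasoning

ℤ→ℚ-injective : ∀ {a b} → ℤ→ℚ a ≡ ℤ→ℚ b → a ≡ b
ℤ→ℚ-injective {a} {b} eq
  with ℚᵘP.≃-trans (ℚᵘP.≃-sym (toℚᵘ-ℤ→ℚ a)) (ℚᵘP.≃-trans (ℚP.toℚᵘ-cong eq) (toℚᵘ-ℤ→ℚ b))
... | *≡* a*1≡b*1 = trans (sym (ℤP.*-identityʳ a)) (trans a*1≡b*1 (ℤP.*-identityʳ b))

ℤ→ℚ-mono-≤ : ∀ {a b} → a ℤ.≤ b → ℤ→ℚ a ℚ.≤ ℤ→ℚ b
ℤ→ℚ-mono-≤ {a} {b} a≤b = ℚP.toℚᵘ-cancel-≤ (begin
  ℚ.toℚᵘ (ℤ→ℚ a)  ≃⟨ toℚᵘ-ℤ→ℚ a ⟩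
  mkℚᵘ a 0         ≤⟨ *≤* (ℤP.*-monoʳ-≤-nonNeg (+ 1) a≤b) ⟩
  mkℚᵘ b 0         ≃⟨ toℚᵘ-ℤ→ℚ b ⟨
  ℚ.toℚᵘ (ℤ→ℚ b)  ∎)
  where open ℚᵘP.≤-Reasoning

ℤ→ℚ-homo-sum : ∀ {n} (f : Fin n → ℤ) → ℤ→ℚ (ℤΣ.sum f) ≡ ∑[ i < n ] (ℤ→ℚ (f i))
ℤ→ℚ-homo-sum {zero} f = refl
ℤ→ℚ-homo-sum {suc n} f =
  trans (ℤ→ℚ-homo-+ (f zero) (ℤΣ.sum (f ∘ suc))) (cong (ℤ→ℚ (f zero) ℚ.+_) (ℤ→ℚ-homo-sum (f ∘ suc)))

Σℚ≡∑ : ∀ n (f : Fin n → ℚ) → Σℚ n f ≡ ∑[ i < n ] (f i)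
Σℚ≡∑ zero f = refl
Σℚ≡∑ (suc n) f = cong (f zero ℚ.+_) (Σℚ≡∑ n (f ∘ suc))

∑-nonPos : ∀ {n} (f : Fin n → ℚ) → (∀ i → f i ℚ.≤ 0ℚ) → ∑[ i < n ] (f i) ℚ.≤ 0ℚ
∑-nonPos {zero} f f≤0 = ℚP.≤-refl
∑-nonPos {suc n} f f≤0 = ℚP.+-mono-≤ (f≤0 zero) (∑-nonPos (f ∘ suc) (f≤0 ∘ suc))

DA : ∀ {n} → Matrix n → (Fin n → ℚ) → Fin n → Fin n → ℚ
DA A d i j = d i ℚ.* ℤ→ℚ (A i j)

form : ∀ {n} → (Fin n → Fin n → ℚ) → (Fin n → ℚ) → ℚ
form {n} M x = ∑[ i < n ] (∑[ j < n ] (x i ℚ.* M i j ℚ.* x j))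

Σℚ-form : ∀ {n} (M : Fin n → Fin n → ℚ) x →
  Σℚ n (λ i → Σℚ n (λ j → x i ℚ.* M i j ℚ.* x j)) ≡ form M x
Σℚ-form {n} M x = trans (Σℚ≡∑ n _) (sum-cong-≗ (λ i → Σℚ≡∑ n (λ j → x i ℚ.* M i j ℚ.* x j)))

form-rows : ∀ {n} (M : Fin n → Fin n → ℚ) x → form M x ≡ ∑[ i < n ] ((∑[ j < n ] (M i j ℚ.* x j)) ℚ.* x i)
form-rows {n} M x = sum-cong-≗ λ i → begin
  ∑[ j < n ] (x i ℚ.* M i j ℚ.* x j)    ≡⟨ sum-cong-≗ (λ j → ℚP.*-assoc (x i) (M i j) (x j)) ⟩
  ∑[ j < n ] (x i ℚ.* (M i j ℚ.* x j))  ≡⟨ *-distribˡ-sum (x i) (λ j → M i j ℚ.* x j) ⟨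
  x i ℚ.* ∑[ j < n ] (M i j ℚ.* x j)    ≡⟨ ℚP.*-comm (x i) _ ⟩
  ∑[ j < n ] (M i j ℚ.* x j) ℚ.* x i    ∎
  where open ≡-Reasoning

-- For injective f this is c extended by zero along f.
pushforward : ∀ {m n} → (Fin m → Fin n) → (Fin m → ℚ) → Fin n → ℚ
pushforward {m} f c j = ∑[ k < m ] (if does (f k ≟ j) then c k else 0ℚ)

∑-pushforward : ∀ {m n} (f : Fin m → Fin n) c (g : Fin n → ℚ) →
  ∑[ j < n ] (g j ℚ.* pushforward f c j) ≡ ∑[ k < m ] (g (f k) ℚ.* c k)
∑-pushforward {m} {n} f c g = begin
  ∑[ j < n ] (g j ℚ.* pushforward f c j)   ≡⟨ sum-cong-≗ (λ j → *-distribˡ-sum (g j) (λ k → δ k j)) ⟩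
  ∑[ j < n ] (∑[ k < m ] (g j ℚ.* δ k j))  ≡⟨ ∑-comm (λ j k → g j ℚ.* δ k j) ⟩
  ∑[ k < m ] (∑[ j < n ] (g j ℚ.* δ k j))  ≡⟨ sum-cong-≗ (λ k → sum-single ℚP.+-0-commutativeMonoid _ (f k) (off-diagonal k)) ⟩
  ∑[ k < m ] (g (f k) ℚ.* δ k (f k))       ≡⟨ sum-cong-≗ (λ k → cong (g (f k) ℚ.*_) (on-diagonal k)) ⟩
  ∑[ k < m ] (g (f k) ℚ.* c k)             ∎
  where
  open ≡-Reasoning
  δ : Fin m → Fin n → ℚ
  δ k j = if does (f k ≟ j) then c k else 0ℚ
  on-diagonal : ∀ k → δ k (f k) ≡ c k
  on-diagonal k = cong (λ t → if t then c k else 0ℚ) (dec-true (f k ≟ f k) refl)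
  off-diagonal : ∀ k j → j ≢ f k → g j ℚ.* δ k j ≡ 0ℚ
  off-diagonal k j j≢fk =
    trans (cong (λ b → g j ℚ.* (if b then c k else 0ℚ)) (dec-false (f k ≟ j) (j≢fk ∘ sym))) (ℚP.*-zeroʳ (g j))

pushforward-injective : ∀ {m n} {f : Fin m → Fin n} → Injective _≡_ _≡_ f →
  ∀ c k → pushforward f c (f k) ≡ c k
pushforward-injective {f = f} f-inj c k =
  trans (sum-single ℚP.+-0-commutativeMonoid _ k off-diagonal)
        (cong (λ t → if t then c k else 0ℚ) (dec-true (f k ≟ f k) refl))
  where
  off-diagonal : ∀ l → l ≢ k → (if does (f l ≟ f k) then c l else 0ℚ) ≡ 0ℚ
  off-diagonal l l≢k = cong (λ b → if b then c l else 0ℚ) (dec-false (f l ≟ f k) (l≢k ∘ f-inj))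

form-pushforward : ∀ {m n} (M : Fin n → Fin n → ℚ) (f : Fin m → Fin n) c →
  form M (pushforward f c) ≡ form (λ k l → M (f k) (f l)) c
form-pushforward {m} {n} M f c = begin
  form M x                                                  ≡⟨ form-rows M x ⟩
  ∑[ i < n ] (∑[ j < n ] (M i j ℚ.* x j) ℚ.* x i)
    ≡⟨ sum-cong-≗ (λ i → cong (ℚ._* x i) (∑-pushforward f c (M i))) ⟩
  ∑[ i < n ] (∑[ l < m ] (M i (f l) ℚ.* c l) ℚ.* x i)
    ≡⟨ ∑-pushforward f c (λ i → ∑[ l < m ] (M i (f l) ℚ.* c l)) ⟩
  ∑[ k < m ] (∑[ l < m ] (M (f k) (f l) ℚ.* c l) ℚ.* c k)   ≡⟨ form-rows (λ k l → M (f k) (f l)) c ⟨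
  form (λ k l → M (f k) (f l)) c                            ∎
  where
  open ≡-Reasoning
  x = pushforward f c

principal : ∀ {m n} → Matrix n → (Fin m → Fin n) → Matrix m
principal A f k l = A (f k) (f l)

principal-positive : ∀ {m n} {A : Matrix n} {f : Fin m → Fin n} → Injective _≡_ _≡_ f →
  IsPositiveQuasiCartan A → IsPositiveQuasiCartan (principal A f)
principal-positive {A = A} {f} f-inj (diag , d , (d>0 , dA-sym) , dA-pd) =
  diag ∘ f , d ∘ f , (d>0 ∘ f , λ k l → dA-sym (f k) (f l)) , dA′-pd
  where
  dA′-pd : DAPositiveDefinite (principal A f) (d ∘ f)
  dA′-pd c (k , cₖ≢0) = subst (0ℚ ℚ.<_) same-form (dA-pd (pushforward f c) (f k , xₖ≢0))
    where
    xₖ≢0 : pushforward f c (f k) ≢ 0ℚ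
    xₖ≢0 = cₖ≢0 ∘ trans (sym (pushforward-injective f-inj c k))
    same-form = trans (Σℚ-form (DA A d) (pushforward f c))
                (trans (form-pushforward (DA A d) f c) (sym (Σℚ-form (DA (principal A f) (d ∘ f)) c)))

_*ᵥ_ : ∀ {n} → Matrix n → (Fin n → ℤ) → Fin n → ℤ
(A *ᵥ y) i = ℤΣ.sum (λ j → A i j ℤ.* y j)

form-DA-integral : ∀ {n} (A : Matrix n) d (y : Fin n → ℤ) →
  form (DA A d) (ℤ→ℚ ∘ y) ≡ ∑[ i < n ] (d i ℚ.* ℤ→ℚ (y i ℤ.* (A *ᵥ y) i))
form-DA-integral {n} A d y = trans (form-rows (DA A d) (ℤ→ℚ ∘ y)) (sum-cong-≗ λ i → begin
  ∑[ j < n ] (d i ℚ.* ℤ→ℚ (A i j) ℚ.* ℤ→ℚ (y j)) ℚ.* ℤ→ℚ (y i)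
    ≡⟨ cong (ℚ._* ℤ→ℚ (y i)) (sum-cong-≗ λ j →
         trans (ℚP.*-assoc (d i) _ _) (cong (d i ℚ.*_) (sym (ℤ→ℚ-homo-* (A i j) (y j))))) ⟩
  ∑[ j < n ] (d i ℚ.* ℤ→ℚ (A i j ℤ.* y j)) ℚ.* ℤ→ℚ (y i)
    ≡⟨ cong (ℚ._* ℤ→ℚ (y i)) (*-distribˡ-sum (d i) (λ j → ℤ→ℚ (A i j ℤ.* y j))) ⟨
  d i ℚ.* ∑[ j < n ] (ℤ→ℚ (A i j ℤ.* y j)) ℚ.* ℤ→ℚ (y i)
    ≡⟨ cong (λ q → d i ℚ.* q ℚ.* ℤ→ℚ (y i)) (ℤ→ℚ-homo-sum (λ j → A i j ℤ.* y j)) ⟨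
  d i ℚ.* ℤ→ℚ ((A *ᵥ y) i) ℚ.* ℤ→ℚ (y i)
    ≡⟨ ℚP.*-assoc (d i) _ _ ⟩
  d i ℚ.* (ℤ→ℚ ((A *ᵥ y) i) ℚ.* ℤ→ℚ (y i))
    ≡⟨ cong (d i ℚ.*_) (ℤ→ℚ-homo-* ((A *ᵥ y) i) (y i)) ⟨
  d i ℚ.* ℤ→ℚ ((A *ᵥ y) i ℤ.* y i)
    ≡⟨ cong (λ z → d i ℚ.* ℤ→ℚ z) (ℤP.*-comm ((A *ᵥ y) i) (y i)) ⟩
  d i ℚ.* ℤ→ℚ (y i ℤ.* (A *ᵥ y) i)
    ∎)
  where open ≡-Reasoning

RowwiseNonPositive : ∀ {n} → Matrix n → (Fin n → ℤ) → Set
RowwiseNonPositive A y = ∀ i → y i ℤ.* (A *ᵥ y) i ℤ.≤ + 0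

rowwiseNonPositive⇒zero : ∀ {n} (A : Matrix n) → IsPositiveQuasiCartan A →
  (y : Fin n → ℤ) → RowwiseNonPositive A y → ∀ i → y i ≡ + 0
rowwiseNonPositive⇒zero A (_ , d , (d>0 , _) , dA-pd) y nonPos i with y i ℤ.≟ + 0
... | yes yᵢ≡0 = yᵢ≡0
... | no yᵢ≢0 = contradiction (ℚP.<-≤-trans form>0 form≤0) (ℚP.<-irrefl refl)
  where
  form>0 : 0ℚ ℚ.< form (DA A d) (ℤ→ℚ ∘ y)
  form>0 = subst (0ℚ ℚ.<_) (Σℚ-form (DA A d) (ℤ→ℚ ∘ y)) (dA-pd (ℤ→ℚ ∘ y) (i , yᵢ≢0 ∘ ℤ→ℚ-injective))
  term≤0 : ∀ k → d k ℚ.* ℤ→ℚ (y k ℤ.* (A *ᵥ y) k) ℚ.≤ 0ℚ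
  term≤0 k = subst (d k ℚ.* ℤ→ℚ (y k ℤ.* (A *ᵥ y) k) ℚ.≤_) (ℚP.*-zeroʳ (d k))
    (ℚP.*-monoˡ-≤-nonNeg (d k) {{ℚP.pos⇒nonNeg (d k) {{ℚ.positive (d>0 k)}}}} (ℤ→ℚ-mono-≤ (nonPos k)))
  form≤0 : form (DA A d) (ℤ→ℚ ∘ y) ℚ.≤ 0ℚ
  form≤0 = subst (ℚ._≤ 0ℚ) (sym (form-DA-integral A d y)) (∑-nonPos _ term≤0)

weight≡0⇒entry≡0 : ∀ {n} (A : Matrix n) {d} → IsSymmetrizer A d → ∀ i j → weight A i j ≡ + 0 → A i j ≡ + 0
weight≡0⇒entry≡0 A {d} (d>0 , dA-sym) i j wᵢⱼ≡0 with ℤP.i*j≡0⇒i≡0∨j≡0 (A i j) wᵢⱼ≡0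
... | inj₁ Aᵢⱼ≡0 = Aᵢⱼ≡0
... | inj₂ Aⱼᵢ≡0 =
  ℤ→ℚ-injective (ℚP.≤-antisym (cancel (ℚP.≤-reflexive dᵢAᵢⱼ≡0)) (cancel (ℚP.≤-reflexive (sym dᵢAᵢⱼ≡0))))
  where
  cancel : ∀ {p q} → d i ℚ.* p ℚ.≤ d i ℚ.* q → p ℚ.≤ q
  cancel = ℚP.*-cancelˡ-≤-pos (d i) {{ℚ.positive (d>0 i)}}
  dᵢAᵢⱼ≡0 : d i ℚ.* ℤ→ℚ (A i j) ≡ d i ℚ.* 0ℚ
  dᵢAᵢⱼ≡0 = begin
    d i ℚ.* ℤ→ℚ (A i j)   ≡⟨ dA-sym i j ⟩
    d j ℚ.* ℤ→ℚ (A j i)   ≡⟨ cong (λ a → d j ℚ.* ℤ→ℚ a) Aⱼᵢ≡0 ⟩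
    d j ℚ.* 0ℚ            ≡⟨ ℚP.*-zeroʳ (d j) ⟩
    0ℚ                    ≡⟨ ℚP.*-zeroʳ (d i) ⟨
    d i ℚ.* 0ℚ            ∎
    where open ≡-Reasoning

HasDiagram : ∀ {m} → Matrix m → WGraph m → Set
HasDiagram {m} B G = (i j : Fin m) → i ≢ j → weight B i j ≡ + G i j

NotPositiveDiagram : ∀ {m} → WGraph m → Set
NotPositiveDiagram {m} G = (B : Matrix m) → IsPositiveQuasiCartan B → ¬ HasDiagram B G

notPositiveDiagram⇒¬subdiagram : ∀ {m n} {G : WGraph m} → NotPositiveDiagram G →
  (A : Matrix n) → IsPositiveQuasiCartan A → ¬ HasSubdiagram A G
notPositiveDiagram⇒¬subdiagram G-bad A A-pos (f , f-inj , G-diagram) =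
  G-bad (principal A f) (principal-positive {A = A} f-inj A-pos) G-diagram

star-notPositive : ∀ {L} (B : Matrix (suc L)) → IsPositiveQuasiCartan B →
  (∀ j j' → j ≢ j' → weight B (suc j) (suc j') ≡ + 0) →
  + 4 ℤ.≤ ℤΣ.sum (λ j → weight B zero (suc j)) → ⊥
star-notPositive {L} B B-pos@(diag , _ , symmetrizer , _) leaves-apart 4≤∑w =
  contradiction (rowwiseNonPositive⇒zero B B-pos y rows zero) λ ()
  where
  y : Fin (suc L) → ℤ
  y zero = ℤ.- + 2
  y (suc j) = B (suc j) zero

  centre : y zero ℤ.* (B *ᵥ y) zero ℤ.≤ + 0
  centre rewrite diag zero = ℤP.*-monoˡ-≤-nonPos (ℤ.- + 2)
    (subst (+ 0 ℤ.≤_) (ℤP.+-comm (ℤΣ.sum (λ j → weight B zero (suc j))) (ℤ.- + 4)) (ℤP.i≤j⇒0≤j-i 4≤∑w))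

  leaf-row : ∀ j → (B *ᵥ y) (suc j) ≡ + 0
  leaf-row j = begin
    B (suc j) zero ℤ.* (ℤ.- + 2) ℤ.+ ℤΣ.sum (λ j′ → B (suc j) (suc j′) ℤ.* B (suc j′) zero)
      ≡⟨ cong (λ s → B (suc j) zero ℤ.* (ℤ.- + 2) ℤ.+ s) (sum-single ℤP.+-0-commutativeMonoid _ j off-diagonal) ⟩
    B (suc j) zero ℤ.* (ℤ.- + 2) ℤ.+ B (suc j) (suc j) ℤ.* B (suc j) zero
      ≡⟨ cong (λ b → B (suc j) zero ℤ.* (ℤ.- + 2) ℤ.+ b ℤ.* B (suc j) zero) (diag (suc j)) ⟩
    B (suc j) zero ℤ.* (ℤ.- + 2) ℤ.+ + 2 ℤ.* B (suc j) zero
      ≡⟨ cancels (B (suc j) zero) ⟩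
    + 0 ∎
    where
    open ≡-Reasoning
    cancels : ∀ b → b ℤ.* (ℤ.- + 2) ℤ.+ + 2 ℤ.* b ≡ + 0
    cancels = solve-∀
    off-diagonal : ∀ j′ → j′ ≢ j → B (suc j) (suc j′) ℤ.* B (suc j′) zero ≡ + 0
    off-diagonal j′ j′≢j = trans
      (cong (ℤ._* B (suc j′) zero) (weight≡0⇒entry≡0 B symmetrizer _ _ (leaves-apart j j′ (j′≢j ∘ sym))))
      (ℤP.*-zeroˡ (B (suc j′) zero))

  rows : RowwiseNonPositive B y
  rows zero = centre
  rows (suc j) = ℤP.≤-reflexive (trans (cong (y (suc j) ℤ.*_) (leaf-row j)) (ℤP.*-zeroʳ (y (suc j))))

starDiagram-notPositive : ∀ {L} (G : WGraph (suc L)) → (∀ j j′ → j ≢ j′ → G (suc j) (suc j′) ≡ 0) →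
  + 4 ℤ.≤ ℤΣ.sum (λ j → + G zero (suc j)) → NotPositiveDiagram G
starDiagram-notPositive G leaves-apart 4≤∑w B B-pos B-diagram = star-notPositive B B-pos
  (λ j j′ j≢j′ → trans (B-diagram _ _ (j≢j′ ∘ FinP.suc-injective)) (cong +_ (leaves-apart j j′ j≢j′)))
  (subst (+ 4 ℤ.≤_) (ℤΣ.sum-cong-≗ (λ j → sym (B-diagram zero (suc j) λ ()))) 4≤∑w)

relabel-notPositive : ∀ {m} {G : WGraph m} {f : Fin m → Fin m} → Injective _≡_ _≡_ f →
  NotPositiveDiagram (λ k l → G (f k) (f l)) → NotPositiveDiagram G
relabel-notPositive {f = f} f-inj G∘f-bad B B-pos B-diagram =
  G∘f-bad (principal B f) (principal-positive {A = B} f-inj B-pos)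
          (λ k l k≢l → B-diagram (f k) (f l) (k≢l ∘ f-inj))

Btilde3-notPositive : NotPositiveDiagram Btilde3
Btilde3-notPositive = starDiagram-notPositive Btilde3 (λ _ _ _ → refl) ℤP.≤-refl

Dtilde4-notPositive : NotPositiveDiagram Dtilde4
Dtilde4-notPositive = starDiagram-notPositive Dtilde4 (λ _ _ _ → refl) ℤP.≤-refl

Gtilde2-notPositive : ∀ a → 1 ≤ a → NotPositiveDiagram (Gtilde2 a)
Gtilde2-notPositive a 1≤a = relabel-notPositive (Injection.injective (↔⇒↣ centre↔0))
  (starDiagram-notPositive _
    (λ { zero zero _ → refl ; zero (suc zero) _ → refl ; (suc zero) zero _ → refl ; (suc zero) (suc zero) _ → refl })
    (ℤ.+≤+ (s≤s (s≤s (s≤s (ℕP.m≤n⇒m≤n+o 0 1≤a))))))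
  where
  -- swapping vertices 0 and 1 makes the middle vertex of the path the centre of a star
  centre↔0 = transpose zero (suc zero)

Far : ℕ → ℕ → Set
Far i j = suc i ℕ.< j ⊎ suc j ℕ.< i

far⇒≢ : ∀ {i j} → Far i j → i ≢ j
far⇒≢ (inj₁ 1+i<i) refl = ℕP.1+n≰n (ℕP.<⇒≤ 1+i<i)
far⇒≢ (inj₂ 1+i<i) refl = ℕP.1+n≰n (ℕP.<⇒≤ 1+i<i)

far⇒≢suc : ∀ {i j} → Far i j → j ≢ suc i
far⇒≢suc (inj₁ 1+i<1+i) refl = ℕP.<-irrefl refl 1+i<1+i
far⇒≢suc (inj₂ 2+i<i) refl = ℕP.1+n≰n (ℕP.≤-trans (ℕP.m≤n+m _ 2) 2+i<i)

-- Offsets are added on the right (toℕ i + a, w + a) so that windows of literal width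
-- unfold definitionally at the call sites below.
∑-window : ∀ {m} a w (h : ℕ → ℤ) → w ℕ.+ a ≤ m →
  (∀ l → l ℕ.< m → l ℕ.< a ⊎ w ℕ.+ a ≤ l → h l ≡ + 0) →
  ℤΣ.sum {m} (λ l → h (toℕ l)) ≡ ℤΣ.sum {w} (λ i → h (toℕ i ℕ.+ a))
∑-window {m} zero zero h _ vanish =
  trans (ℤΣ.sum-cong-≗ (λ l → vanish (toℕ l) (FinP.toℕ<n l) (inj₂ z≤n))) (ℤΣ.sum-replicate-zero m)
∑-window {suc m} zero (suc w) h (s≤s w≤m) vanish =
  cong (ℤ._+_ (h 0)) (∑-window zero w (h ∘ suc) w≤m λ l l<m → λ
    { (inj₂ w≤l) → vanish (suc l) (s≤s l<m) (inj₂ (s≤s w≤l)) })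
∑-window {zero} (suc a) w h w+1+a≤0 _ = contradiction (subst (_≤ 0) (ℕP.+-suc w a) w+1+a≤0) λ ()
∑-window {suc m} (suc a) w h w+1+a≤1+m vanish = begin
  h 0 ℤ.+ ℤΣ.sum {m} (λ l → h (suc (toℕ l)))   ≡⟨ cong (ℤ._+ ℤΣ.sum {m} (λ l → h (suc (toℕ l)))) h0≡0 ⟩
  + 0 ℤ.+ ℤΣ.sum {m} (λ l → h (suc (toℕ l)))   ≡⟨ ℤP.+-identityˡ _ ⟩
  ℤΣ.sum {m} (λ l → h (suc (toℕ l)))           ≡⟨ ∑-window a w (h ∘ suc) w+a≤m vanish′ ⟩
  ℤΣ.sum {w} (λ i → h (suc (toℕ i ℕ.+ a)))     ≡⟨ ℤΣ.sum-cong-≗ {w} (λ i → cong h (ℕP.+-suc (toℕ i) a)) ⟨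
  ℤΣ.sum {w} (λ i → h (toℕ i ℕ.+ suc a))       ∎
  where
  open ≡-Reasoning
  h0≡0 : h 0 ≡ + 0
  h0≡0 = vanish 0 (s≤s z≤n) (inj₁ (s≤s z≤n))
  w+a≤m : w ℕ.+ a ≤ m
  w+a≤m = ℕP.≤-pred (subst (_≤ suc m) (ℕP.+-suc w a) w+1+a≤1+m)
  vanish′ : ∀ l → l ℕ.< m → l ℕ.< a ⊎ w ℕ.+ a ≤ l → h (suc l) ≡ + 0
  vanish′ l l<m (inj₁ l<a) = vanish (suc l) (s≤s l<m) (inj₁ (s≤s l<a))
  vanish′ l l<m (inj₂ w+a≤l) =
    vanish (suc l) (s≤s l<m) (inj₂ (subst (_≤ suc l) (sym (ℕP.+-suc w a)) (s≤s w+a≤l)))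

-- The path matrix is indexed by ℕ, so that the sign recursion along the path is
-- structural; only the entries with both indices ≤ n are constrained.
module PathNullVector
  (p : ℕ) (b : ℕ → ℕ → ℤ)
  (b-diag : ∀ k → b k k ≡ + 2)
  (b-far : ∀ i j → i ≤ 2 ℕ.+ p → j ≤ 2 ℕ.+ p → Far i j → b i j ≡ + 0)
  (b-first : b 0 1 ℤ.* b 1 0 ≡ + 2)
  (b-middle : ∀ k → 0 ℕ.< k → k ℕ.< suc p → b k (suc k) ℤ.* b (suc k) k ≡ + 1)
  (b-last : b (suc p) (2 ℕ.+ p) ℤ.* b (2 ℕ.+ p) (suc p) ≡ + 2)
  where

  n : ℕ
  n = 2 ℕ.+ p

  sign : ℕ → ℤ
  sign zero = + 1
  sign (suc k) = ℤ.- (b (suc k) k ℤ.* sign k)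

  nullVector : ℕ → ℤ
  nullVector k = if does (k ℕ.≟ n) then sign k else + 2 ℤ.* sign k

  nullVector-last : nullVector n ≡ sign n
  nullVector-last = cong (λ t → if t then sign n else + 2 ℤ.* sign n) (dec-true (n ℕ.≟ n) refl)

  nullVector-inner : ∀ {k} → k ℕ.< n → nullVector k ≡ + 2 ℤ.* sign k
  nullVector-inner {k} k<n =
    cong (λ t → if t then sign k else + 2 ℤ.* sign k) (dec-false (k ℕ.≟ n) (ℕP.<⇒≢ k<n))

  left-term : ∀ k → k ≤ p → b (suc k) k ℤ.* nullVector k ≡ ℤ.- (+ 2 ℤ.* sign (suc k))
  left-term k k≤p = trans (cong (b (suc k) k ℤ.*_) (nullVector-inner (ℕP.m≤n⇒m≤1+n (s≤s k≤p))))
                          (identity (b (suc k) k) (sign k))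
    where
    identity : ∀ x s → x ℤ.* (+ 2 ℤ.* s) ≡ ℤ.- (+ 2 ℤ.* ℤ.- (x ℤ.* s))
    identity = solve-∀

  right-term-by-weight : ∀ k → k ≤ p →
    b k (suc k) ℤ.* nullVector (suc k) ≡ ℤ.- (+ 2 ℤ.* ((b k (suc k) ℤ.* b (suc k) k) ℤ.* sign k))
  right-term-by-weight k k≤p = trans (cong (b k (suc k) ℤ.*_) (nullVector-inner (s≤s (s≤s k≤p))))
                                     (identity (b k (suc k)) (b (suc k) k) (sign k))
    where
    identity : ∀ x y s → x ℤ.* (+ 2 ℤ.* ℤ.- (y ℤ.* s)) ≡ ℤ.- (+ 2 ℤ.* ((x ℤ.* y) ℤ.* s))
    identity = solve-∀

  right-term : ∀ k → k ≤ p → b (suc k) (suc (suc k)) ℤ.* nullVector (suc (suc k)) ≡ ℤ.- (+ 2 ℤ.* sign (suc k))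
  right-term k k≤p with ℕP.m≤n⇒m<n∨m≡n k≤p
  ... | inj₁ k<p = begin
    b (suc k) (suc (suc k)) ℤ.* nullVector (suc (suc k))
      ≡⟨ right-term-by-weight (suc k) k<p ⟩
    ℤ.- (+ 2 ℤ.* ((b (suc k) (suc (suc k)) ℤ.* b (suc (suc k)) (suc k)) ℤ.* sign (suc k)))
      ≡⟨ cong (λ w → ℤ.- (+ 2 ℤ.* (w ℤ.* sign (suc k)))) (b-middle (suc k) (s≤s z≤n) (s≤s k<p)) ⟩
    ℤ.- (+ 2 ℤ.* (+ 1 ℤ.* sign (suc k)))
      ≡⟨ cong (λ s → ℤ.- (+ 2 ℤ.* s)) (ℤP.*-identityˡ (sign (suc k))) ⟩
    ℤ.- (+ 2 ℤ.* sign (suc k)) ∎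
    where open ≡-Reasoning
  ... | inj₂ refl = begin
    b (suc p) n ℤ.* nullVector n                    ≡⟨ cong (b (suc p) n ℤ.*_) nullVector-last ⟩
    b (suc p) n ℤ.* ℤ.- (b n (suc p) ℤ.* sign (suc p)) ≡⟨ identity (b (suc p) n) (b n (suc p)) (sign (suc p)) ⟩
    ℤ.- ((b (suc p) n ℤ.* b n (suc p)) ℤ.* sign (suc p)) ≡⟨ cong (λ w → ℤ.- (w ℤ.* sign (suc p))) b-last ⟩
    ℤ.- (+ 2 ℤ.* sign (suc p))                      ∎
    where
    open ≡-Reasoning
    identity : ∀ x y s → x ℤ.* ℤ.- (y ℤ.* s) ≡ ℤ.- ((x ℤ.* y) ℤ.* s)
    identity = solve-∀

  off-band : ∀ K l → K ≤ n → l ℕ.< suc n → Far K l → b K l ℤ.* nullVector l ≡ + 0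
  off-band K l K≤n l<1+n far =
    trans (cong (ℤ._* nullVector l) (b-far K l K≤n (ℕP.≤-pred l<1+n) far)) (ℤP.*-zeroˡ (nullVector l))

  row-first : ℤΣ.sum {suc n} (λ l → b 0 (toℕ l) ℤ.* nullVector (toℕ l)) ≡ + 0
  row-first = begin
    ℤΣ.sum {suc n} (λ l → b 0 (toℕ l) ℤ.* nullVector (toℕ l))
      ≡⟨ ∑-window 0 2 (λ l → b 0 l ℤ.* nullVector l) (s≤s (s≤s z≤n)) vanish ⟩
    b 0 0 ℤ.* nullVector 0 ℤ.+ (b 0 1 ℤ.* nullVector 1 ℤ.+ + 0)
      ≡⟨ cong₂ (λ x y → x ℤ.* (+ 2 ℤ.* + 1) ℤ.+ (y ℤ.+ + 0)) (b-diag 0) first-right ⟩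
    + 0 ∎
    where
    open ≡-Reasoning
    vanish : ∀ l → l ℕ.< suc n → l ℕ.< 0 ⊎ 2 ≤ l → b 0 l ℤ.* nullVector l ≡ + 0
    vanish l l<1+n (inj₂ 2≤l) = off-band 0 l z≤n l<1+n (inj₁ 2≤l)
    first-right : b 0 1 ℤ.* nullVector 1 ≡ ℤ.- (+ 4)
    first-right = trans (right-term-by-weight 0 z≤n) (cong (λ w → ℤ.- (+ 2 ℤ.* (w ℤ.* + 1))) b-first)
  row-inner : ∀ k → k ≤ p → ℤΣ.sum {suc n} (λ l → b (suc k) (toℕ l) ℤ.* nullVector (toℕ l)) ≡ + 0
  row-inner k k≤p = begin
    ℤΣ.sum {suc n} (λ l → b (suc k) (toℕ l) ℤ.* nullVector (toℕ l))
      ≡⟨ ∑-window k 3 (λ l → b (suc k) l ℤ.* nullVector l) (s≤s (s≤s (s≤s k≤p))) vanish ⟩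
    b (suc k) k ℤ.* nullVector k ℤ.+
      (b (suc k) (suc k) ℤ.* nullVector (suc k) ℤ.+ (b (suc k) (suc (suc k)) ℤ.* nullVector (suc (suc k)) ℤ.+ + 0))
      ≡⟨ cong₂ (λ x y → x ℤ.+ y) (left-term k k≤p) (cong₂ (λ x y → x ℤ.+ (y ℤ.+ + 0)) centre (right-term k k≤p)) ⟩
    ℤ.- (+ 2 ℤ.* s) ℤ.+ (+ 2 ℤ.* (+ 2 ℤ.* s) ℤ.+ (ℤ.- (+ 2 ℤ.* s) ℤ.+ + 0))
      ≡⟨ identity s ⟩
    + 0 ∎
    where
    open ≡-Reasoning
    s = sign (suc k)
    centre : b (suc k) (suc k) ℤ.* nullVector (suc k) ≡ + 2 ℤ.* (+ 2 ℤ.* s)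
    centre = cong₂ ℤ._*_ (b-diag (suc k)) (nullVector-inner (s≤s (s≤s k≤p)))
    identity : ∀ s → ℤ.- (+ 2 ℤ.* s) ℤ.+ (+ 2 ℤ.* (+ 2 ℤ.* s) ℤ.+ (ℤ.- (+ 2 ℤ.* s) ℤ.+ + 0)) ≡ + 0
    identity = solve-∀
    vanish : ∀ l → l ℕ.< suc n → l ℕ.< k ⊎ 3 ℕ.+ k ≤ l → b (suc k) l ℤ.* nullVector l ≡ + 0
    vanish l l<1+n (inj₁ l<k) = off-band (suc k) l (s≤s (ℕP.m≤n⇒m≤1+n k≤p)) l<1+n (inj₂ (s≤s l<k))
    vanish l l<1+n (inj₂ 3+k≤l) = off-band (suc k) l (s≤s (ℕP.m≤n⇒m≤1+n k≤p)) l<1+n (inj₁ 3+k≤l)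
  row-last : ℤΣ.sum {suc n} (λ l → b n (toℕ l) ℤ.* nullVector (toℕ l)) ≡ + 0
  row-last = begin
    ℤΣ.sum {suc n} (λ l → b n (toℕ l) ℤ.* nullVector (toℕ l))
      ≡⟨ ∑-window (suc p) 2 (λ l → b n l ℤ.* nullVector l) ℕP.≤-refl vanish ⟩
    b n (suc p) ℤ.* nullVector (suc p) ℤ.+ (b n n ℤ.* nullVector n ℤ.+ + 0)
      ≡⟨ cong₂ (λ x y → b n (suc p) ℤ.* x ℤ.+ (y ℤ.+ + 0))
               (nullVector-inner ℕP.≤-refl) (cong₂ ℤ._*_ (b-diag n) nullVector-last) ⟩
    b n (suc p) ℤ.* (+ 2 ℤ.* s) ℤ.+ (+ 2 ℤ.* ℤ.- (b n (suc p) ℤ.* s) ℤ.+ + 0)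
      ≡⟨ identity (b n (suc p)) s ⟩
    + 0 ∎
    where
    open ≡-Reasoning
    s = sign (suc p)
    identity : ∀ x s → x ℤ.* (+ 2 ℤ.* s) ℤ.+ (+ 2 ℤ.* ℤ.- (x ℤ.* s) ℤ.+ + 0) ≡ + 0
    identity = solve-∀
    vanish : ∀ l → l ℕ.< suc n → l ℕ.< suc p ⊎ 2 ℕ.+ suc p ≤ l → b n l ℤ.* nullVector l ≡ + 0
    vanish l l<1+n (inj₁ l<1+p) = off-band n l ℕP.≤-refl l<1+n (inj₂ (s≤s l<1+p))
    vanish l l<1+n (inj₂ 1+n≤l) = contradiction (ℕP.<-≤-trans l<1+n 1+n≤l) (ℕP.<-irrefl refl)

  row : ∀ K → K ≤ n → ℤΣ.sum {suc n} (λ l → b K (toℕ l) ℤ.* nullVector (toℕ l)) ≡ + 0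
  row zero    _           = row-first
  row (suc k) (s≤s k≤1+p) with ℕP.m≤n⇒m<n∨m≡n k≤1+p
  ... | inj₁ (s≤s k≤p) = row-inner k k≤p
  ... | inj₂ refl      = row-last

clamp : ∀ n → ℕ → Fin (suc n)
clamp zero    _       = zero
clamp (suc n) zero    = zero
clamp (suc n) (suc i) = suc (clamp n i)

clamp-toℕ : ∀ {n} (i : Fin (suc n)) → clamp n (toℕ i) ≡ i
clamp-toℕ {zero}  zero    = refl
clamp-toℕ {suc n} zero    = refl
clamp-toℕ {suc n} (suc i) = cong suc (clamp-toℕ i)

toℕ-clamp : ∀ {n i} → i ≤ n → toℕ (clamp n i) ≡ i
toℕ-clamp {zero}  z≤n     = refl
toℕ-clamp {suc n} z≤n     = refl
toℕ-clamp {suc n} (s≤s i≤n) = cong suc (toℕ-clamp i≤n)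

clamp-injective : ∀ {n i j} → i ≤ n → j ≤ n → clamp n i ≡ clamp n j → i ≡ j
clamp-injective i≤n j≤n eq = trans (sym (toℕ-clamp i≤n)) (trans (cong toℕ eq) (toℕ-clamp j≤n))

Ctilde-far : ∀ {n} (i j : Fin (suc n)) {k l} → toℕ i ≡ k → toℕ j ≡ l → Far k l → Ctilde n i j ≡ 0
Ctilde-far i j refl refl far with toℕ j ℕ.≟ suc (toℕ i) | toℕ i ℕ.≟ suc (toℕ j)
... | yes j≡1+i | _       = contradiction j≡1+i (far⇒≢suc far)
... | no _      | yes i≡1+j = contradiction i≡1+j (far⇒≢suc (swap far))
... | no _      | no _    = refl

Ctilde-middle : ∀ {n} (i j : Fin (suc n)) {k} → toℕ i ≡ k → toℕ j ≡ suc k → 0 ℕ.< k → suc k ℕ.< n →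
  Ctilde n i j ≡ 1
Ctilde-middle {n} i j refl j≡1+k 0<k 1+k<n with toℕ j ℕ.≟ suc (toℕ i) | toℕ i ℕ.≟ suc (toℕ j)
... | no j≢1+k | _ = contradiction j≡1+k j≢1+k
... | yes _    | _ with toℕ i ℕ.≟ 0 | suc (toℕ i) ℕ.≟ n
...   | yes k≡0 | _        = contradiction k≡0 (ℕP.>⇒≢ 0<k)
...   | no _    | yes 1+k≡n = contradiction 1+k≡n (ℕP.<⇒≢ 1+k<n)
...   | no _    | no _     = refl

Ctilde-last : ∀ {n} (i j : Fin (suc n)) {k} → toℕ i ≡ k → toℕ j ≡ suc k → suc k ≡ n → Ctilde n i j ≡ 2
Ctilde-last {n} i j refl j≡1+k 1+k≡n with toℕ j ℕ.≟ suc (toℕ i) | toℕ i ℕ.≟ suc (toℕ j)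
... | no j≢1+k | _ = contradiction j≡1+k j≢1+k
... | yes _    | _ with toℕ i ℕ.≟ 0 | suc (toℕ i) ℕ.≟ n
...   | yes _ | _          = refl
...   | no _  | yes _      = refl
...   | no _  | no 1+k≢n   = contradiction 1+k≡n 1+k≢n

Ctilde-notPositive : ∀ n → 2 ≤ n → NotPositiveDiagram (Ctilde n)
Ctilde-notPositive n@(suc (suc p)) (s≤s (s≤s z≤n)) B B-pos@(diag , _ , symmetrizer , _) B-diagram =
  contradiction (rowwiseNonPositive⇒zero B B-pos y rows zero) λ ()
  where
  b : ℕ → ℕ → ℤ
  b i j = B (clamp n i) (clamp n j)

  b-weight : ∀ {i j} → i ≤ n → j ≤ n → i ≢ j → b i j ℤ.* b j i ≡ + Ctilde n (clamp n i) (clamp n j)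
  b-weight i≤n j≤n i≢j = B-diagram _ _ (i≢j ∘ clamp-injective i≤n j≤n)

  b-far : ∀ i j → i ≤ n → j ≤ n → Far i j → b i j ≡ + 0
  b-far i j i≤n j≤n far = weight≡0⇒entry≡0 B symmetrizer _ _
    (trans (b-weight i≤n j≤n (far⇒≢ far)) (cong +_ (Ctilde-far _ _ (toℕ-clamp i≤n) (toℕ-clamp j≤n) far)))

  b-middle : ∀ k → 0 ℕ.< k → k ℕ.< suc p → b k (suc k) ℤ.* b (suc k) k ≡ + 1
  b-middle k 0<k k<1+p = trans (b-weight k≤n (s≤s k≤1+p) (ℕP.<⇒≢ (ℕP.n<1+n k)))
    (cong +_ (Ctilde-middle _ _ (toℕ-clamp k≤n) (toℕ-clamp (s≤s k≤1+p)) 0<k (s≤s k<1+p)))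
    where
    k≤1+p = ℕP.<⇒≤ k<1+p
    k≤n = ℕP.m≤n⇒m≤1+n k≤1+p

  b-last : b (suc p) n ℤ.* b n (suc p) ≡ + 2
  b-last = trans (b-weight (ℕP.n≤1+n _) ℕP.≤-refl (ℕP.<⇒≢ (ℕP.n<1+n _)))
    (cong +_ (Ctilde-last (clamp n (suc p)) (clamp n n) (toℕ-clamp (ℕP.n≤1+n _)) (toℕ-clamp ℕP.≤-refl) refl))

  open PathNullVector p b (diag ∘ clamp n) b-far (B-diagram zero (suc zero) λ ()) b-middle b-last
    using (nullVector; row)

  y : Fin (suc n) → ℤ
  y l = nullVector (toℕ l)

  rows : RowwiseNonPositive B y
  rows k = ℤP.≤-reflexive (trans (cong (y k ℤ.*_) B·y≡0) (ℤP.*-zeroʳ (y k)))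
    where
    B·y≡0 : (B *ᵥ y) k ≡ + 0
    B·y≡0 = trans
      (ℤΣ.sum-cong-≗ λ l → cong₂ (λ k′ l′ → B k′ l′ ℤ.* y l) (sym (clamp-toℕ k)) (sym (clamp-toℕ l)))
      (row (toℕ k) (FinP.toℕ≤pred[n] k))

corollary2p5 : {N : ℕ} → (A : Matrix N) → IsPositiveQuasiCartan A →
    ((n : ℕ) → 2 ≤ n → ¬ HasSubdiagram A (Ctilde n)) ×
    ¬ HasSubdiagram A Btilde3 ×
    ¬ HasSubdiagram A Dtilde4 ×
    ((a : ℕ) → 1 ≤ a → ¬ HasSubdiagram A (Gtilde2 a))
corollary2p5 A A-pos =
  (λ n 2≤n → excluded (Ctilde-notPositive n 2≤n)) ,
  excluded Btilde3-notPositive ,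
  excluded Dtilde4-notPositive ,
  (λ a 1≤a → excluded (Gtilde2-notPositive a 1≤a))
  where
  excluded : ∀ {m} {G : WGraph m} → NotPositiveDiagram G → ¬ HasSubdiagram A G
  excluded G-bad = notPositiveDiagram⇒¬subdiagram G-bad A A-pos
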